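{- For each integer $\Delta>0$ and each even integer $d>0$ there exist a non-negative matrix $A\in\mathbb{Z}_{\ge 0}^{d\times d}$ with $\lVert A\rVert_\infty=\Delta$, a right-hand side $b\in\mathbb{Z}_{\ge 0}^d$ and a right-hand side $b'\in\mathbb{Z}_{\ge 0}^d$ with $\lVert b-b'\rVert_1=1$ such that $\mathrm{sens}(A,b,b')\ge \Delta^{\Theta(d)}$. Furthermore, the underlying ILP is polytopish.
   Context: For $x\in\mathbb{R}^n$ and $Y\subseteq\mathbb{R}^n$ let $\mathrm{dist}(x,Y)=\min_{y\in Y}\lVert x-y\rVert_\infty$, and for $X,Y\subseteq\mathbb{R}^n$ let $\mathrm{dist}(X,Y)=\max_{x\in X}\mathrm{dist}(x,Y)$. For $A\in\mathbb{Z}^{d\times n}$ of full row rank, $b\in\mathbb{Z}^d$ and objective $c\in\mathbb{Z}^n$, let $\mathrm{IntSol}(A,b,c)$ be the set of optimal solutions of $\min\{c^\top x: Ax=b,\ x\in\mathbb{Z}^n_{\ge 0}\}$. The sensitivity is $\mathrm{sens}(A,b,b',c)=\mathrm{dist}(\mathrm{IntSol}(A,b,c),\mathrm{IntSol}(A,b',c))$, and $\mathrm{sens}(A,b,b')$ denotes this quantity with the zero objective $c=0$ (so $\mathrm{IntSol}$ is the set of all non-negative integral solutions). $\Delta$ denotes $\lVert A\rVert_\infty$, the largest absolute value of an entry of $A$. "$\ge\Delta^{\Theta(d)}$" means at least $\Delta^{\gamma d}$ for an absolute constant $\gamma>0$ independent of $\Delta$ and $d$. An ILP $\min\{c^\top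 x: Ax=b, x\in\mathbb{Z}^n_{\ge0}\}$ is called polytopish if there is a polytope $\mathcal{P}\subseteq\mathbb{R}^d$ such that the columns of $A$ are exactly the integer points of $\mathcal{P}$ (each appearing once), i.e. the ILP has the form $\min\{c^\top x:\sum_{p\in\mathcal{P}\cap\mathbb{Z}^d}x_p p=b,\ x\ge 0 \text{ integral}\}$. -}

module Defs where

open import Data.Nat using (ℕ; zero; suc; _⊔_; ∣_-_∣; _^_; _*_; _≤_; _<_)
import Data.Nat as ℕ
open import Data.Integer as ℤ using (ℤ; +_)
open import Data.Rational as ℚ using (ℚ; 0ℚ; 1ℚ; _/_)
open import Data.Fin using (Fin; zero; suc)
open import Data.Product using (Σ; ∃; _×_; _,_)
open import Relation.Binary.PropositionalEquality using (_≡_)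

Σℕ : ∀ {n} → (Fin n → ℕ) → ℕ
Σℕ {zero}  f = 0
Σℕ {suc n} f = f zero ℕ.+ Σℕ (λ i → f (suc i))

maxℕ : ∀ {n} → (Fin n → ℕ) → ℕ
maxℕ {zero}  f = 0
maxℕ {suc n} f = f zero ⊔ maxℕ (λ i → f (suc i))

Σℤ : ∀ {n} → (Fin n → ℤ) → ℤ
Σℤ {zero}  f = + 0
Σℤ {suc n} f = f zero ℤ.+ Σℤ (λ i → f (suc i))

Σℚ : ∀ {n} → (Fin n → ℚ) → ℚ
Σℚ {zero}  f = 0ℚ
Σℚ {suc n} f = f zero ℚ.+ Σℚ (λ i → f (suc i))

Mat : ℕ → ℕ → Set
Mat d n = Fin d → Fin n → ℕ

‖_‖∞ₘ : ∀ {d n} → Mat d n → ℕ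
‖ A ‖∞ₘ = maxℕ (λ i → maxℕ (λ j → A i j))

dist∞ : ∀ {n} → (Fin n → ℕ) → (Fin n → ℕ) → ℕ
dist∞ x y = maxℕ (λ i → ∣ x i - y i ∣)

dist₁ : ∀ {n} → (Fin n → ℕ) → (Fin n → ℕ) → ℕ
dist₁ x y = Σℕ (λ i → ∣ x i - y i ∣)

-- full row rank: the rows of A are linearly independent over ℚ
-- (stated with integer coefficients, equivalent by clearing denominators)
FullRowRank : ∀ {d n} → Mat d n → Set
FullRowRank {d} {n} A =
  (λ' : Fin d → ℤ) → (∀ j → Σℤ (λ i → λ' i ℤ.* (+ A i j)) ≡ + 0) → ∀ i → λ' i ≡ + 0

-- x is a non-negative integral solution of A x = b
-- (with c = 0, IntSol(A,b,0) is exactly the set of these)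
IsSol : ∀ {d n} → Mat d n → (Fin d → ℕ) → (Fin n → ℕ) → Set
IsSol A b x = ∀ i → Σℕ (λ j → A i j * x j) ≡ b i

-- sens(A,b,b')^q ≥ B:
-- IntSol(A,b') is non-empty and some x ∈ IntSol(A,b) has
-- dist(x, IntSol(A,b'))^q ≥ B, i.e. ‖x - y‖∞ ^ q ≥ B for all y ∈ IntSol(A,b').
SensAtLeast : ∀ {d n} → Mat d n → (b b' : Fin d → ℕ) → (q B : ℕ) → Set
SensAtLeast {d} {n} A b b' q B =
  (∃ λ (y : Fin n → ℕ) → IsSol A b' y) ×
  (∃ λ (x : Fin n → ℕ) → IsSol A b x ×
      (∀ (y : Fin n → ℕ) → IsSol A b' y → B ≤ dist∞ x y ^ q))

InConv : ∀ {d m} → (Fin m → Fin d → ℚ) → (Fin d → ℚ) → Set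
InConv {d} {m} V z =
  Σ (Fin m → ℚ) λ μ →
    (∀ k → 0ℚ ℚ.≤ μ k) × (Σℚ μ ≡ 1ℚ) × (∀ t → Σℚ (λ k → μ k ℚ.* V k t) ≡ z t)

Polytopish : ∀ {d n} → Mat d n → Set
Polytopish {d} {n} A =
  (∀ j j' → (∀ i → A i j ≡ A i j') → j ≡ j') ×
  (Σ ℕ λ m → Σ (Fin m → Fin d → ℚ) λ V →
     ∀ (z : Fin d → ℤ) →
       (InConv V (λ t → z t / 1) → ∃ λ j → ∀ i → z i ≡ + A i j) ×
       ((∃ λ j → ∀ i → z i ≡ + A i j) → InConv V (λ t → z t / 1)))

module Submission where

-- Let A be the d × d matrix with 1 on the diagonal and Δ directly below it. It is unimodular and
-- lower triangular, so A y = b has at most one solution. The vectors x = (0, Δ, 0, Δ³, …) and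
-- x' = (1, 0, Δ², 0, …) satisfy (A x)ᵢ = (A x')ᵢ = Δ^i for i ≥ 1, while (A x)₀ = 0 and (A x')₀ = 1;
-- yet x and x' differ by Δ^(d-1) in the last coordinate, so the sensitivity is Δ^(d-1) ≥ Δ^(d/2).
-- Only the first column has a non-zero first entry, so in a convex combination of the columns the
-- weight of the first column equals the first coordinate; for an integer point it is 0 or 1, and
-- induction on d shows that the columns are the only integer points of their convex hull.

open import Defs
open import Data.Nat using (ℕ; _<_; _*_; _^_)
open import Data.Nat.Divisibility using (_∣_)
open import Data.Fin using (Fin)
open import Data.Product using (Σ; ∃; _×_; _,_)
open import Relation.Binary.PropositionalEquality using (_≡_)

open import Function using (_∘_)
open import Data.Product using (proj₁)
open import Data.Nat using (zero; suc; _+_; _≤_; z≤n; s≤s; ∣_-_∣; NonZero; >-nonZero)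
import Data.Nat.Properties as ℕₚ
open import Data.Nat.Divisibility using (divides)
open import Data.Fin using (zero; suc; toℕ; fromℕ)
open import Data.Fin.Properties using (toℕ-fromℕ)
open import Data.Integer as ℤ using (ℤ; +_; -[1+_]; +≤+)
import Data.Integer.Properties as ℤₚ
open import Data.Integer.GCD using (gcd; gcd-zeroʳ)
open import Data.Rational as ℚ using (ℚ; 0ℚ; 1ℚ; _/_; ↥_; ↧_; *≤*)
import Data.Rational.Properties as ℚₚ
open import Algebra.Properties.Group ℚₚ.+-0-group using (∙-cancelˡ)
open import Algebra.Properties.CommutativeSemigroup ℕₚ.*-commutativeSemigroup
  using (x∙yz≈y∙xz)
open import Data.Sum using (_⊎_; inj₁; inj₂)
open import Relation.Binary.PropositionalEquality
  using (refl; sym; trans; cong; cong₂; subst; subst₂; _≗_; module ≡-Reasoning)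

Σℕ-zero : ∀ {n} {f : Fin n → ℕ} → (∀ i → f i ≡ 0) → Σℕ f ≡ 0
Σℕ-zero {zero}  _    = refl
Σℕ-zero {suc n} f≡0 = cong₂ _+_ (f≡0 zero) (Σℕ-zero (f≡0 ∘ suc))

Σℕ-*-factor : ∀ {n} c (f g : Fin n → ℕ) → Σℕ (λ j → f j * (c * g j)) ≡ c * Σℕ (λ j → f j * g j)
Σℕ-*-factor {zero}  c f g = sym (ℕₚ.*-zeroʳ c)
Σℕ-*-factor {suc n} c f g = begin
  f zero * (c * g zero) + Σℕ (λ j → f (suc j) * (c * g (suc j)))
    ≡⟨ cong₂ _+_ (x∙yz≈y∙xz (f zero) c (g zero)) (Σℕ-*-factor c (f ∘ suc) (g ∘ suc)) ⟩
  c * (f zero * g zero) + c * Σℕ (λ j → f (suc j) * g (suc j))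
    ≡⟨ ℕₚ.*-distribˡ-+ c (f zero * g zero) _ ⟨
  c * (f zero * g zero + Σℕ (λ j → f (suc j) * g (suc j))) ∎
  where open ≡-Reasoning

≤-maxℕ : ∀ {n} (f : Fin n → ℕ) i → f i ≤ maxℕ f
≤-maxℕ f zero    = ℕₚ.m≤m⊔n _ _
≤-maxℕ f (suc i) = ℕₚ.≤-trans (≤-maxℕ (f ∘ suc) i) (ℕₚ.m≤n⊔m (f zero) _)

maxℕ-lub : ∀ {n} {f : Fin n → ℕ} {c} → (∀ i → f i ≤ c) → maxℕ f ≤ c
maxℕ-lub {zero}  _   = z≤n
maxℕ-lub {suc n} f≤c = ℕₚ.⊔-lub (f≤c zero) (maxℕ-lub (f≤c ∘ suc))

‖‖∞ₘ-attained : ∀ {d n} (M : Mat d n) {c} → (∀ i j → M i j ≤ c) → ∀ i j → M i j ≡ c → ‖ M ‖∞ₘ ≡ c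
‖‖∞ₘ-attained M M≤c i j Mij≡c = ℕₚ.≤-antisym
  (maxℕ-lub (λ i → maxℕ-lub (M≤c i)))
  (subst (_≤ ‖ M ‖∞ₘ) Mij≡c
    (ℕₚ.≤-trans (≤-maxℕ (M i) j) (≤-maxℕ (λ i → maxℕ (M i)) i)))

Σℤ-zero : ∀ {n} {f : Fin n → ℤ} → (∀ i → f i ≡ + 0) → Σℤ f ≡ + 0
Σℤ-zero {zero}  _    = refl
Σℤ-zero {suc n} f≡0 = cong₂ ℤ._+_ (f≡0 zero) (Σℤ-zero (f≡0 ∘ suc))

Σℚ-cong : ∀ {n} {f g : Fin n → ℚ} → f ≗ g → Σℚ f ≡ Σℚ g
Σℚ-cong {zero}  _   = refl
Σℚ-cong {suc n} f≗g = cong₂ ℚ._+_ (f≗g zero) (Σℚ-cong (f≗g ∘ suc))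

Σℚ-zero : ∀ {n} {f : Fin n → ℚ} → (∀ i → f i ≡ 0ℚ) → Σℚ f ≡ 0ℚ
Σℚ-zero {zero}  _    = refl
Σℚ-zero {suc n} f≡0 = trans (cong₂ ℚ._+_ (f≡0 zero) (Σℚ-zero (f≡0 ∘ suc))) (ℚₚ.+-identityʳ 0ℚ)

Σℚ-head : ∀ {n} (f : Fin (suc n) → ℚ) → (∀ i → f (suc i) ≡ 0ℚ) → Σℚ f ≡ f zero
Σℚ-head f tail≡0 = trans (cong (f zero ℚ.+_) (Σℚ-zero tail≡0)) (ℚₚ.+-identityʳ (f zero))

Σℚ-tail : ∀ {n} (f : Fin (suc n) → ℚ) → f zero ≡ 0ℚ → Σℚ f ≡ Σℚ (f ∘ suc)
Σℚ-tail f head≡0 = trans (cong (ℚ._+ Σℚ (f ∘ suc)) head≡0) (ℚₚ.+-identityˡ _)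

Σℚ-nonNeg : ∀ {n} {f : Fin n → ℚ} → (∀ i → 0ℚ ℚ.≤ f i) → 0ℚ ℚ.≤ Σℚ f
Σℚ-nonNeg {zero}  _    = ℚₚ.≤-refl
Σℚ-nonNeg {suc n} f≥0 = ℚₚ.+-mono-≤ (f≥0 zero) (Σℚ-nonNeg (f≥0 ∘ suc))

p≤p+q : ∀ p {q} → 0ℚ ℚ.≤ q → p ℚ.≤ p ℚ.+ q
p≤p+q p {q} q≥0 = subst (ℚ._≤ p ℚ.+ q) (ℚₚ.+-identityʳ p) (ℚₚ.+-mono-≤ (ℚₚ.≤-refl {p}) q≥0)

Σℚ-nonNeg-≡0 : ∀ {n} {f : Fin n → ℚ} → (∀ i → 0ℚ ℚ.≤ f i) → Σℚ f ≡ 0ℚ → ∀ i → f i ≡ 0ℚ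
Σℚ-nonNeg-≡0 {suc n} {f} f≥0 Σf≡0 = λ where
    zero    → f₀≡0
    (suc i) → Σℚ-nonNeg-≡0 (f≥0 ∘ suc) (trans (sym (Σℚ-tail f f₀≡0)) Σf≡0) i
  where
  f₀≡0 : f zero ≡ 0ℚ
  f₀≡0 = ℚₚ.≤-antisym (subst (f zero ℚ.≤_) Σf≡0 (p≤p+q (f zero) (Σℚ-nonNeg (f≥0 ∘ suc)))) (f≥0 zero)

↥[z/1]≡z : ∀ z → ↥ (z / 1) ≡ z
↥[z/1]≡z z = begin
  ↥ (z / 1)                     ≡⟨ ℤₚ.*-identityʳ _ ⟨
  ↥ (z / 1) ℤ.* + 1             ≡⟨ cong (↥ (z / 1) ℤ.*_) (gcd-zeroʳ z) ⟨
  ↥ (z / 1) ℤ.* gcd z (+ 1)     ≡⟨ ℚₚ.↥-/ z 1 ⟩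
  z                             ∎
  where open ≡-Reasoning

↧[z/1]≡1 : ∀ z → ↧ (z / 1) ≡ + 1
↧[z/1]≡1 z = begin
  ↧ (z / 1)                     ≡⟨ ℤₚ.*-identityʳ _ ⟨
  ↧ (z / 1) ℤ.* + 1             ≡⟨ cong (↧ (z / 1) ℤ.*_) (gcd-zeroʳ z) ⟨
  ↧ (z / 1) ℤ.* gcd z (+ 1)     ≡⟨ ℚₚ.↧-/ z 1 ⟩
  + 1                           ∎
  where open ≡-Reasoning

/1-injective : ∀ {z w} → z / 1 ≡ w / 1 → z ≡ w
/1-injective {z} {w} eq = trans (sym (↥[z/1]≡z z)) (trans (cong ↥_ eq) (↥[z/1]≡z w))

/1-cancel-≤ : ∀ {z w} → z / 1 ℚ.≤ w / 1 → z ℤ.≤ w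
/1-cancel-≤ {z} {w} le = subst₂ ℤ._≤_ (numerator z w) (numerator w z) (ℚₚ.drop-*≤* le)
  where
  numerator : ∀ x y → ↥ (x / 1) ℤ.* ↧ (y / 1) ≡ x
  numerator x y = trans (cong₂ ℤ._*_ (↥[z/1]≡z x) (↧[z/1]≡1 y)) (ℤₚ.*-identityʳ x)

0≤z/1≤1⇒z≡0⊎z≡1 : ∀ z → 0ℚ ℚ.≤ z / 1 → z / 1 ℚ.≤ 1ℚ → z ≡ + 0 ⊎ z ≡ + 1
0≤z/1≤1⇒z≡0⊎z≡1 z 0≤z z≤1 = cases z (/1-cancel-≤ 0≤z) (/1-cancel-≤ z≤1)
  where
  cases : ∀ z → + 0 ℤ.≤ z → z ℤ.≤ + 1 → z ≡ + 0 ⊎ z ≡ + 1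
  cases (+ 0)           _ _                 = inj₁ refl
  cases (+ 1)           _ _                 = inj₂ refl
  cases (+ suc (suc _)) _ (+≤+ (s≤s ()))
  cases -[1+ _ ]        () _

module Bidiagonal (Δ : ℕ) where

  -- The clause for (suc i) (suc j) precedes the first-column clauses so that A (suc i) (suc j)
  -- reduces to A i j definitionally for every i.
  A : ∀ {n} → Mat n n
  A zero          zero    = 1
  A zero          (suc _) = 0
  A (suc i)       (suc j) = A i j
  A (suc zero)    zero    = Δ
  A (suc (suc _)) zero    = 0

  apply : ∀ {n} → (Fin n → ℕ) → Fin n → ℕ
  apply y i = Σℕ (λ j → A i j * y j)

  apply-zero : ∀ {n} (y : Fin (suc n) → ℕ) → apply y zero ≡ y zero
  apply-zero {n} y = trans (cong₂ _+_ (ℕₚ.+-identityʳ (y zero)) (Σℕ-zero {n} (λ _ → refl)))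
                           (ℕₚ.+-identityʳ (y zero))

  apply-* : ∀ {n} c (y : Fin n → ℕ) i → apply (λ j → c * y j) i ≡ c * apply y i
  apply-* c y i = Σℕ-*-factor c (A i) y

  apply-injective : ∀ {n} {y z : Fin n → ℕ} → apply y ≗ apply z → y ≗ z
  apply-injective {suc n} {y} {z} Ay≗Az = λ where
      zero    → y₀≡z₀
      (suc i) → apply-injective tail-equal i
    where
    y₀≡z₀ : y zero ≡ z zero
    y₀≡z₀ = trans (sym (apply-zero y)) (trans (Ay≗Az zero) (apply-zero z))
    tail-equal : apply (y ∘ suc) ≗ apply (z ∘ suc)
    tail-equal i = ℕₚ.+-cancelˡ-≡ (A (suc i) zero * z zero) _ _
      (trans (cong (λ v → A (suc i) zero * v + apply (y ∘ suc) i) (sym y₀≡z₀)) (Ay≗Az (suc i)))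

  evenPowers oddPowers : ∀ {n} → Fin n → ℕ
  evenPowers zero    = 1
  evenPowers (suc t) = Δ * oddPowers t
  oddPowers  zero    = 0
  oddPowers  (suc t) = Δ * evenPowers t

  apply-evenPowers : ∀ {n} (i : Fin n) → apply evenPowers i ≡ Δ ^ toℕ i
  apply-oddPowers  : ∀ {n} (i : Fin n) → apply {suc n} oddPowers (suc i) ≡ Δ ^ suc (toℕ i)

  apply-evenPowers {suc n} zero = apply-zero {n} evenPowers
  apply-evenPowers {suc (suc n)} (suc zero) = begin
    Δ * 1 + apply {suc n} (λ j → Δ * oddPowers j) zero
      ≡⟨ cong (_+_ (Δ * 1)) (apply-* Δ (oddPowers {suc n}) zero) ⟩
    Δ * 1 + Δ * apply {suc n} oddPowers zero
      ≡⟨ cong (λ v → Δ * 1 + Δ * v) (apply-zero {n} oddPowers) ⟩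
    Δ * 1 + Δ * 0
      ≡⟨ cong (_+_ (Δ * 1)) (ℕₚ.*-zeroʳ Δ) ⟩
    Δ * 1 + 0
      ≡⟨ ℕₚ.+-identityʳ (Δ * 1) ⟩
    Δ * 1 ∎
    where open ≡-Reasoning
  apply-evenPowers (suc (suc i)) =
    trans (apply-* Δ oddPowers (suc i)) (cong (Δ *_) (apply-oddPowers i))

  apply-oddPowers i = begin
    A (suc i) zero * 0 + apply (λ j → Δ * evenPowers j) i
      ≡⟨ cong₂ _+_ (ℕₚ.*-zeroʳ (A (suc i) zero)) (apply-* Δ evenPowers i) ⟩
    Δ * apply evenPowers i
      ≡⟨ cong (Δ *_) (apply-evenPowers i) ⟩
    Δ * Δ ^ toℕ i ∎
    where open ≡-Reasoning

  ∣oddPowers-evenPowers∣ : ∀ {n} (t : Fin n) → ∣ oddPowers t - evenPowers t ∣ ≡ Δ ^ toℕ t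
  ∣oddPowers-evenPowers∣ zero    = refl
  ∣oddPowers-evenPowers∣ (suc t) = begin
    ∣ Δ * evenPowers t - Δ * oddPowers t ∣   ≡⟨ ℕₚ.*-distribˡ-∣-∣ Δ (evenPowers t) (oddPowers t) ⟨
    Δ * ∣ evenPowers t - oddPowers t ∣       ≡⟨ cong (Δ *_) (ℕₚ.∣-∣-comm (evenPowers t) (oddPowers t)) ⟩
    Δ * ∣ oddPowers t - evenPowers t ∣       ≡⟨ cong (Δ *_) (∣oddPowers-evenPowers∣ t) ⟩
    Δ * Δ ^ toℕ t                            ∎
    where open ≡-Reasoning

  A-fullRowRank : ∀ {n} → FullRowRank (A {n})
  A-fullRowRank {suc n} l lA≡0 = λ where
      zero    → l₀≡0
      (suc i) → tail≡0 i
    where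
    tail≡0 : ∀ i → l (suc i) ≡ + 0
    tail≡0 = A-fullRowRank (l ∘ suc) λ k →
      trans (sym (trans (cong (ℤ._+ Σℤ (λ i → l (suc i) ℤ.* + A i k)) (ℤₚ.*-zeroʳ (l zero)))
                        (ℤₚ.+-identityˡ _)))
            (lA≡0 (suc k))
    column₀-tail≡0 : Σℤ (λ i → l (suc i) ℤ.* + A (suc i) zero) ≡ + 0
    column₀-tail≡0 = Σℤ-zero λ i →
      trans (cong (ℤ._* + A (suc i) zero) (tail≡0 i)) (ℤₚ.*-zeroˡ (+ A (suc i) zero))
    l₀≡0 : l zero ≡ + 0
    l₀≡0 = begin
      l zero                                                      ≡⟨ ℤₚ.*-identityʳ (l zero) ⟨
      l zero ℤ.* + 1                                              ≡⟨ ℤₚ.+-identityʳ _ ⟨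
      l zero ℤ.* + 1 ℤ.+ + 0
        ≡⟨ cong (ℤ._+_ (l zero ℤ.* + 1)) column₀-tail≡0 ⟨
      l zero ℤ.* + 1 ℤ.+ Σℤ (λ i → l (suc i) ℤ.* + A (suc i) zero) ≡⟨ lA≡0 zero ⟩
      + 0                                                         ∎
      where open ≡-Reasoning

  A-entries-≤ : 0 < Δ → ∀ {n} (i j : Fin n) → A i j ≤ Δ
  A-entries-≤ 0<Δ zero          zero    = 0<Δ
  A-entries-≤ 0<Δ zero          (suc _) = z≤n
  A-entries-≤ 0<Δ (suc i)       (suc j) = A-entries-≤ 0<Δ i j
  A-entries-≤ 0<Δ (suc zero)    zero    = ℕₚ.≤-refl
  A-entries-≤ 0<Δ (suc (suc _)) zero    = z≤n

  A-columns-injective : ∀ {n} (j j' : Fin n) → (∀ i → A i j ≡ A i j') → j ≡ j'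
  A-columns-injective zero    zero     _      = refl
  A-columns-injective zero    (suc _)  A≡ with () ← A≡ zero
  A-columns-injective (suc _) zero     A≡ with () ← A≡ zero
  A-columns-injective (suc j) (suc j') A≡ = cong suc (A-columns-injective j j' (A≡ ∘ suc))

  vertex : ∀ {n} → Fin n → Fin n → ℚ
  vertex k t = + A t k / 1

  indicator : ∀ {n} → Fin n → Fin n → ℚ
  indicator zero    zero    = 1ℚ
  indicator zero    (suc _) = 0ℚ
  indicator (suc _) zero    = 0ℚ
  indicator (suc j) (suc k) = indicator j k

  indicator-nonNeg : ∀ {n} (j k : Fin n) → 0ℚ ℚ.≤ indicator j k
  indicator-nonNeg zero    zero    = *≤* (+≤+ z≤n)
  indicator-nonNeg zero    (suc _) = ℚₚ.≤-refl
  indicator-nonNeg (suc _) zero    = ℚₚ.≤-refl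
  indicator-nonNeg (suc j) (suc k) = indicator-nonNeg j k

  Σℚ-indicator : ∀ {n} (j : Fin n) (g : Fin n → ℚ) → Σℚ (λ k → indicator j k ℚ.* g k) ≡ g j
  Σℚ-indicator zero    g = trans (Σℚ-head (λ k → indicator zero k ℚ.* g k) (λ k → ℚₚ.*-zeroˡ (g (suc k))))
                                 (ℚₚ.*-identityˡ (g zero))
  Σℚ-indicator (suc j) g = trans (Σℚ-tail (λ k → indicator (suc j) k ℚ.* g k) (ℚₚ.*-zeroˡ (g zero)))
                                 (Σℚ-indicator j (g ∘ suc))

  column-inConv : ∀ {n} (z : Fin n → ℤ) → (∃ λ j → ∀ i → z i ≡ + A i j) → InConv vertex (λ t → z t / 1)
  column-inConv z (j , z≡Aj) =
    indicator j ,
    indicator-nonNeg j ,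
    trans (Σℚ-cong (λ k → sym (ℚₚ.*-identityʳ (indicator j k)))) (Σℚ-indicator j (λ _ → 1ℚ)) ,
    λ t → trans (Σℚ-indicator j (λ k → vertex k t)) (cong (_/ 1) (sym (z≡Aj t)))

  vertex-combination-head : ∀ {n} (μ : Fin (suc n) → ℚ) → Σℚ (λ k → μ k ℚ.* vertex k zero) ≡ μ zero
  vertex-combination-head μ = trans (Σℚ-head (λ k → μ k ℚ.* vertex k zero) (λ k → ℚₚ.*-zeroʳ (μ (suc k))))
                      (ℚₚ.*-identityʳ (μ zero))

  weight₀≡z₀ : ∀ {n} (z : Fin (suc n) → ℤ) (c : InConv vertex (λ t → z t / 1)) → proj₁ c zero ≡ z zero / 1
  weight₀≡z₀ z (μ , _ , _ , μV≡z) = trans (sym (vertex-combination-head μ)) (μV≡z zero)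

  inConv⇒z₀≡0⊎z₀≡1 : ∀ {n} (z : Fin (suc n) → ℤ) → InConv vertex (λ t → z t / 1) → z zero ≡ + 0 ⊎ z zero ≡ + 1
  inConv⇒z₀≡0⊎z₀≡1 z c@(μ , μ≥0 , Σμ≡1 , _) =
    0≤z/1≤1⇒z≡0⊎z≡1 (z zero) (subst (0ℚ ℚ.≤_) μ₀≡z₀ (μ≥0 zero)) (subst (ℚ._≤ 1ℚ) μ₀≡z₀ μ₀≤1)
    where
    μ₀≡z₀ : μ zero ≡ z zero / 1
    μ₀≡z₀ = weight₀≡z₀ z c
    μ₀≤1 : μ zero ℚ.≤ 1ℚ
    μ₀≤1 = subst (μ zero ℚ.≤_) Σμ≡1 (p≤p+q (μ zero) (Σℚ-nonNeg (μ≥0 ∘ suc)))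

  inConv-tail : ∀ {n} (z : Fin (suc n) → ℤ) (c : InConv vertex (λ t → z t / 1)) →
                proj₁ c zero ≡ 0ℚ → InConv vertex (λ t → z (suc t) / 1)
  inConv-tail z (μ , μ≥0 , Σμ≡1 , μV≡z) μ₀≡0 = μ ∘ suc , μ≥0 ∘ suc , tail-weights , tail-coordinates
    where
    tail-weights : Σℚ (μ ∘ suc) ≡ 1ℚ
    tail-weights = trans (sym (Σℚ-tail μ μ₀≡0)) Σμ≡1
    tail-coordinates : ∀ t → Σℚ (λ k → μ (suc k) ℚ.* vertex k t) ≡ z (suc t) / 1
    tail-coordinates t = trans (sym (Σℚ-tail (λ k → μ k ℚ.* vertex k (suc t)) μ₀v≡0)) (μV≡z (suc t))
      where
      μ₀v≡0 : μ zero ℚ.* vertex zero (suc t) ≡ 0ℚ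
      μ₀v≡0 = trans (cong (ℚ._* vertex zero (suc t)) μ₀≡0) (ℚₚ.*-zeroˡ (vertex zero (suc t)))

  inConv-weight₀≡1⇒column₀ : ∀ {n} (z : Fin (suc n) → ℤ) (c : InConv vertex (λ t → z t / 1)) →
                             proj₁ c zero ≡ 1ℚ → ∀ i → z i ≡ + A i zero
  inConv-weight₀≡1⇒column₀ z (μ , μ≥0 , Σμ≡1 , μV≡z) μ₀≡1 i = /1-injective (begin
    z i / 1                               ≡⟨ μV≡z i ⟨
    Σℚ (λ k → μ k ℚ.* vertex k i)         ≡⟨ Σℚ-head (λ k → μ k ℚ.* vertex k i) tail-terms≡0 ⟩
    μ zero ℚ.* vertex zero i              ≡⟨ cong (ℚ._* vertex zero i) μ₀≡1 ⟩
    1ℚ ℚ.* vertex zero i                  ≡⟨ ℚₚ.*-identityˡ _ ⟩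
    vertex zero i                         ∎)
    where
    open ≡-Reasoning
    tail-sum≡0 : Σℚ (μ ∘ suc) ≡ 0ℚ
    tail-sum≡0 = ∙-cancelˡ 1ℚ _ _ (begin
      1ℚ ℚ.+ Σℚ (μ ∘ suc)       ≡⟨ cong (ℚ._+ Σℚ (μ ∘ suc)) μ₀≡1 ⟨
      μ zero ℚ.+ Σℚ (μ ∘ suc)   ≡⟨ Σμ≡1 ⟩
      1ℚ                        ≡⟨ ℚₚ.+-identityʳ 1ℚ ⟨
      1ℚ ℚ.+ 0ℚ                 ∎)
    tail-terms≡0 : ∀ k → μ (suc k) ℚ.* vertex (suc k) i ≡ 0ℚ
    tail-terms≡0 k = trans (cong (ℚ._* vertex (suc k) i) (Σℚ-nonNeg-≡0 (μ≥0 ∘ suc) tail-sum≡0 k))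
                           (ℚₚ.*-zeroˡ (vertex (suc k) i))

  inConv⇒column : ∀ {n} (z : Fin n → ℤ) → InConv vertex (λ t → z t / 1) → ∃ λ j → ∀ i → z i ≡ + A i j
  inConv⇒column {suc n} z c with inConv⇒z₀≡0⊎z₀≡1 z c
  ... | inj₂ z₀≡1 = zero , inConv-weight₀≡1⇒column₀ z c (trans (weight₀≡z₀ z c) (cong (_/ 1) z₀≡1))
  ... | inj₁ z₀≡0
    with inConv⇒column (z ∘ suc) (inConv-tail z c (trans (weight₀≡z₀ z c) (cong (_/ 1) z₀≡0)))
  ...   | j , z'≡Aj = suc j , λ where
    zero    → z₀≡0
    (suc i) → z'≡Aj i

  A-polytopish : ∀ {n} → Polytopish (A {n})
  A-polytopish {n} = A-columns-injective , n , vertex , λ z → inConv⇒column z , column-inConv z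

  ‖A‖∞ₘ≡Δ : 0 < Δ → ∀ m → ‖ A {2 + m} ‖∞ₘ ≡ Δ
  ‖A‖∞ₘ≡Δ 0<Δ m = ‖‖∞ₘ-attained (A {2 + m}) (A-entries-≤ 0<Δ) (suc zero) zero refl

  dist₁-apply-odd-even : ∀ {n} → dist₁ (apply {suc n} oddPowers) (apply evenPowers) ≡ 1
  dist₁-apply-odd-even {n} = cong₂ _+_
    (cong₂ ∣_-_∣ (apply-zero {n} oddPowers) (apply-zero {n} evenPowers))
    (Σℕ-zero {n} λ i →
      trans (cong₂ ∣_-_∣ (apply-oddPowers i) (apply-evenPowers (suc i))) (ℕₚ.∣n-n∣≡0 (Δ ^ suc (toℕ i))))

  Δ^n≤dist∞-oddPowers : ∀ {n} (y : Fin (suc n) → ℕ) → IsSol A (apply evenPowers) y → Δ ^ n ≤ dist∞ oddPowers y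
  Δ^n≤dist∞-oddPowers {n} y y-sol = begin
    Δ ^ n                                              ≡⟨ cong (Δ ^_) (toℕ-fromℕ n) ⟨
    Δ ^ toℕ (fromℕ n)                                  ≡⟨ ∣oddPowers-evenPowers∣ (fromℕ n) ⟨
    ∣ oddPowers (fromℕ n) - evenPowers (fromℕ n) ∣
      ≡⟨ cong (∣_-_∣ (oddPowers (fromℕ n))) (y≗evenPowers (fromℕ n)) ⟨
    ∣ oddPowers (fromℕ n) - y (fromℕ n) ∣              ≤⟨ ≤-maxℕ (λ i → ∣ oddPowers i - y i ∣) (fromℕ n) ⟩
    dist∞ oddPowers y                                  ∎
    where
    open ℕₚ.≤-Reasoning
    y≗evenPowers : y ≗ evenPowers
    y≗evenPowers = apply-injective y-sol

^[2+m]≤[^[1+m]]^2 : ∀ Δ .{{_ : NonZero Δ}} m → Δ ^ (2 + m) ≤ (Δ ^ (1 + m)) ^ 2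
^[2+m]≤[^[1+m]]^2 Δ m = subst (Δ ^ (2 + m) ≤_) (sym (ℕₚ.^-*-assoc Δ (1 + m) 2))
  (ℕₚ.^-monoʳ-≤ Δ (s≤s (s≤s (ℕₚ.m≤m*n m 2))))

bidiagonal-instance : ∀ Δ m → 0 < Δ →
  Σ (Mat (2 + m) (2 + m)) λ A → Σ (Fin (2 + m) → ℕ) λ b → Σ (Fin (2 + m) → ℕ) λ b' →
    FullRowRank A × (‖ A ‖∞ₘ ≡ Δ) × (dist₁ b b' ≡ 1) ×
    SensAtLeast A b b' 2 (Δ ^ (1 * (2 + m))) × Polytopish A
bidiagonal-instance Δ m 0<Δ =
  A , apply oddPowers , apply evenPowers ,
  A-fullRowRank , ‖A‖∞ₘ≡Δ 0<Δ m , dist₁-apply-odd-even {suc m} , sensitivity , A-polytopish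
  where
  open Bidiagonal Δ
  instance _ = >-nonZero 0<Δ
  sensitivity : SensAtLeast A (apply oddPowers) (apply evenPowers) 2 (Δ ^ (1 * (2 + m)))
  sensitivity = (evenPowers , λ _ → refl) , oddPowers , (λ _ → refl) , λ y y-sol → begin
    Δ ^ (1 * (2 + m))             ≡⟨ cong (Δ ^_) (ℕₚ.*-identityˡ (2 + m)) ⟩
    Δ ^ (2 + m)                   ≤⟨ ^[2+m]≤[^[1+m]]^2 Δ m ⟩
    (Δ ^ (1 + m)) ^ 2             ≤⟨ ℕₚ.^-monoˡ-≤ 2 (Δ^n≤dist∞-oddPowers y y-sol) ⟩
    dist∞ oddPowers y ^ 2         ∎
    where open ℕₚ.≤-Reasoning

theorem1 : Σ ℕ λ p → Σ ℕ λ q → (0 < p) × (0 < q) ×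
    (∀ (Δ d : ℕ) → 0 < Δ → 0 < d → 2 ∣ d →
      Σ (Mat d d) λ A → Σ (Fin d → ℕ) λ b → Σ (Fin d → ℕ) λ b' →
        FullRowRank A × (‖ A ‖∞ₘ ≡ Δ) × (dist₁ b b' ≡ 1) ×
        SensAtLeast A b b' q (Δ ^ (p * d)) × Polytopish A)
-- Evenness of d is only used to exclude d = 1; the construction works for every d ≥ 2.
theorem1 = 1 , 2 , s≤s z≤n , s≤s z≤n , λ where
  Δ (suc (suc m)) 0<Δ _   _                   → bidiagonal-instance Δ m 0<Δ
  _ zero          _   ()  _
  _ (suc zero)    _   _   (divides zero ())
  _ (suc zero)    _   _   (divides (suc _) ())
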